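{- For any sequence of operations on multi-root hollow heaps (as defined and implemented in the context), starting with no heaps, the amortized time per operation is $O(1)$ for each operation other than delete and delete-min, and $O(\log N)$ for each delete or delete-min on a heap of $N$ nodes (full and hollow).
   Context: Heaps. A heap stores a finite set of items, each with a key from a totally ordered universe, and supports: make-heap() (return an empty heap); find-min($h$) (return an item of minimum key in $h$, or null if $h$ is empty); insert($e,k,h$) (add item $e$, which is in no heap, with key $k$); delete-min($h$) (delete from non-empty $h$ the item that find-min($h$) returns); meld($h_1,h_2$) (return a heap containing all items of the item-disjoint heaps $h_1,h_2$); decrease-key($e,k,h$) (given an item $e$ in $h$ with key greater than $k$, change its key to $k$); delete($e,h$) (delete item $e$ from $h$). Heaps passed as arguments are destroyed; decrease-key and delete are given the location of $e$. Nodes. Nodes hold items: each node holds at most one item, and is full if it holds one and hollow otherwise; each item in a heap is held by exactly one node; a newly created node is full and a hollow node never becomes full again. Each node $u$ has a key $u.key$ (the current key of its item if $u$ is full; if $u$ is hollow, the key its item had just before leaving $u$) and a non-negative integer rank $u.rank$. A tree (or dag) of nodes with arcs from parent to child is heap-ordered if $v.key\le w.key$ for every arc $(v,w)$. For two full roots, link makes the one of larger key (ties broken arbitrarily) a child of the other; the new child is the loser and the other the winner. A ranked link is a link of two roots of equal rank and increases the winner's rank by one. Multi-root hollow heap. It is either empty or a set of heap-ordered rooted trees of nodes, together with a pointer to a full root whose key is minimum among all nodes (the minimum node). make-heap returns the empty set of trees; find-min returns the item in the minimum node; meld returns one heap if the other is empty, and otherwise unites the two sets of trees and updates the minimum node;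 insert($e,k,h$) creates a new full node of rank 0 holding $e$ with key $k$ and melds this one-node heap with $h$. decrease-key($e,k,h$), with $u$ the node holding $e$: if $u$ is a root one may simply set $u.key=k$ and update the minimum node; otherwise create a new node $v$, move $e$ from $u$ to $v$ (so $u$ becomes hollow), set $v.key=k$ and $v.rank=\max\{0,u.rank-2\}$, move every child of $u$ of rank less than $v.rank$ (with its subtree) to become a child of $v$, and meld the tree rooted at $v$ with the heap. delete($e,h$) removes $e$ from the node $u$ holding it, making $u$ hollow; if $u$ is not the minimum node this completes the operation; otherwise, while some root is hollow, destroy such a root, making its children roots; then do ranked links while two roots have equal rank; finally make a root of minimum key the minimum node. delete-min($h$) performs delete on the item in the minimum node. Implementation. The children of each node are kept in a singly-linked list in decreasing order by rank (a ranked link makes the loser the first child of the winner; a decrease-key moving an item from $u$ to $v$ moves to $v$ all but the first two children of $u$ if $u.rank>2$, and no children otherwise); the roots of each heap are kept in a singly-linked circular list accessed via the minimum node; and during delete, roots of equal rank to be linked are found using an array of roots indexed by rank. -}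

module Defs where

open import Level using (0ℓ)
open import Relation.Binary.Bundles using (TotalOrder)
open import Data.Nat using (ℕ; zero; suc; _+_; _∸_; _⊔_)
open import Data.Nat.Logarithm using (⌊log₂_⌋)
open import Data.Maybe using (Maybe; just; nothing)
open import Data.List using (List; []; _∷_; _++_; length; map; take; drop; foldr)
open import Data.List.Relation.Unary.Any using (Any)
open import Data.List.Relation.Unary.All using (All)
open import Data.List.Relation.Unary.Unique.Propositional using (Unique)
open import Data.List.Relation.Binary.Permutation.Propositional using (_↭_)
open import Data.Product using (_×_)
open import Relation.Nullary using (¬_)

-- Multi-root hollow heaps, modelled as a (nondeterministic) transition system
-- over a global state consisting of all currently live heaps.
module HollowHeap (O : TotalOrder 0ℓ 0ℓ 0ℓ) (Item : Set) where

  open TotalOrder O public using () renaming (Carrier to Key; _≤_ to _≼_; _≈_ to _≈ₖ_)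

  _≺_ : Key → Key → Set
  k ≺ k′ = (k ≼ k′) × ¬ (k ≈ₖ k′)

  -- A node: the item it holds (nothing = hollow), its key, its rank and its
  -- list of children (in the order of the singly-linked child list).
  data Tree : Set where
    node : (item : Maybe Item) (key : Key) (rank : ℕ) (children : List Tree) → Tree

  key : Tree → Key
  key (node _ k _ _) = k

  rank : Tree → ℕ
  rank (node _ _ r _) = r

  data Full : Tree → Set where
    full : ∀ {e k r cs} → Full (node (just e) k r cs)

  size  : Tree → ℕ
  sizes : List Tree → ℕ
  size (node _ _ _ cs) = suc (sizes cs)
  sizes []       = 0
  sizes (t ∷ ts) = size t + sizes ts

  maxRank : List Tree → ℕ
  maxRank = foldr (λ t m → rank t ⊔ m) 0

  -- A heap is its list of roots; if non-empty, the head is the minimum node.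
  -- (The order of the remaining roots is irrelevant: all relations below
  -- allow arbitrary permutation of root lists.)
  Heap : Set
  Heap = List Tree

  State : Set
  State = List Heap

  data _∈T_ (e : Item) : Tree → Set where
    here  : ∀ {k r cs} → e ∈T node (just e) k r cs
    child : ∀ {i k r cs} → Any (e ∈T_) cs → e ∈T node i k r cs

  _∈S_ : Item → State → Set
  e ∈S S = Any (Any (e ∈T_)) S

  data InList (R : Tree → Tree → Set) : List Tree → List Tree → Set where
    hd : ∀ {t t′ ts} → R t t′ → InList R (t ∷ ts) (t′ ∷ ts)
    tl : ∀ {t ts ts′} → InList R ts ts′ → InList R (t ∷ ts) (t ∷ ts′)

  data Replace (u u′ : Tree) : Tree → Tree → Set where
    here  : Replace u u′ u u′
    there : ∀ {i k r cs cs′} → InList (Replace u u′) cs cs′ →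
            Replace u u′ (node i k r cs) (node i k r cs′)

  data Meld : Heap → Heap → Heap → Set where
    emptyˡ : ∀ {h} → Meld [] h h
    emptyʳ : ∀ {h} → Meld h [] h
    left   : ∀ {m₁ r₁ m₂ r₂ rest} → key m₁ ≼ key m₂ → rest ↭ r₁ ++ (m₂ ∷ r₂) →
             Meld (m₁ ∷ r₁) (m₂ ∷ r₂) (m₁ ∷ rest)
    right  : ∀ {m₁ r₁ m₂ r₂ rest} → key m₂ ≼ key m₁ → rest ↭ (m₁ ∷ r₁) ++ r₂ →
             Meld (m₁ ∷ r₁) (m₂ ∷ r₂) (m₂ ∷ rest)

  -- decrease-key implementation: if u.rank > 2 the new node v receives all
  -- but the first two children of u, otherwise none.
  keepChildren : ℕ → List Tree → List Tree
  keepChildren (suc (suc (suc _))) cs = take 2 cs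
  keepChildren _                   cs = cs

  moveChildren : ℕ → List Tree → List Tree
  moveChildren (suc (suc (suc _))) cs = drop 2 cs
  moveChildren _                   cs = []

  data RankedLink : Tree → Tree → Tree → Set where
    win₁ : ∀ {e₁ k₁ cs₁ e₂ k₂ cs₂ r} → k₁ ≼ k₂ →
           RankedLink (node (just e₁) k₁ r cs₁) (node (just e₂) k₂ r cs₂)
                      (node (just e₁) k₁ (suc r) (node (just e₂) k₂ r cs₂ ∷ cs₁))
    win₂ : ∀ {e₁ k₁ cs₁ e₂ k₂ cs₂ r} → k₂ ≼ k₁ →
           RankedLink (node (just e₁) k₁ r cs₁) (node (just e₂) k₂ r cs₂)
                      (node (just e₂) k₂ (suc r) (node (just e₁) k₁ r cs₁ ∷ cs₂))

  data Destroy : List Tree → List Tree → ℕ → Set where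
    stop    : ∀ {ts} → All Full ts → Destroy ts ts 0
    destroy : ∀ {ts k r cs os ts′ c} → ts ↭ node nothing k r cs ∷ os →
              Destroy (cs ++ os) ts′ c → Destroy ts ts′ (suc (length cs) + c)

  data Link : List Tree → List Tree → ℕ → Set where
    stop : ∀ {ts} → Unique (map rank ts) → Link ts ts 0
    link : ∀ {ts t₁ t₂ os t ts′ c} → ts ↭ t₁ ∷ t₂ ∷ os → RankedLink t₁ t₂ t →
           Link (t ∷ os) ts′ c → Link ts ts′ (suc c)

  data MinFirst : List Tree → Heap → Set where
    empty : MinFirst [] []
    pick  : ∀ {ts m rest} → (m ∷ rest) ↭ ts → All (λ t → key m ≼ key t) rest →
            MinFirst ts (m ∷ rest)

  data Budget : Set where
    cheap : Budget           -- every operation other than delete / delete-min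
    logN  : ℕ → Budget       -- delete / delete-min on a heap of N nodes

  budget : Budget → ℕ
  budget cheap    = 1
  budget (logN n) = suc ⌊log₂ n ⌋

  -- Step S b c S′ : one operation transforms the state S into S′ with actual
  -- cost c (number of elementary steps of the implementation) and budget b.
  data Step : State → Budget → ℕ → State → Set where
    make-heap : ∀ {S} → Step S cheap 1 ([] ∷ S)
    find-min  : ∀ {S h S₀} → S ↭ h ∷ S₀ → Step S cheap 1 S
    insert    : ∀ {S h S₀ h′} (e : Item) (k : Key) → ¬ (e ∈S S) → S ↭ h ∷ S₀ →
                Meld h (node (just e) k 0 [] ∷ []) h′ → Step S cheap 1 (h′ ∷ S₀)
    meld      : ∀ {S h₁ h₂ S₀ h} → S ↭ h₁ ∷ h₂ ∷ S₀ → Meld h₁ h₂ h →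
                Step S cheap 1 (h ∷ S₀)
    decrease-key-min  : ∀ {S e k₀ r cs rs S₀} (k : Key) →
                S ↭ (node (just e) k₀ r cs ∷ rs) ∷ S₀ → k ≺ k₀ →
                Step S cheap 1 ((node (just e) k r cs ∷ rs) ∷ S₀)
    decrease-key-root : ∀ {S m rs S₀ e k₀ r cs os h′} (k : Key) →
                S ↭ (m ∷ rs) ∷ S₀ → rs ↭ node (just e) k₀ r cs ∷ os → k ≺ k₀ →
                Meld (m ∷ os) (node (just e) k r cs ∷ []) h′ →
                Step S cheap 1 (h′ ∷ S₀)
    decrease-key : ∀ {S h S₀ e k₀ r cs h₀ h′} (k : Key) → S ↭ h ∷ S₀ →
                InList (Replace (node (just e) k₀ r cs)
                                (node nothing k₀ r (keepChildren r cs))) h h₀ →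
                k ≺ k₀ →
                Meld h₀ (node (just e) k (r ∸ 2) (moveChildren r cs) ∷ []) h′ →
                Step S cheap 1 (h′ ∷ S₀)
    delete-below-min : ∀ {S i km rm cs cs′ rs S₀ e k r ds} →
                S ↭ (node i km rm cs ∷ rs) ∷ S₀ →
                InList (Replace (node (just e) k r ds) (node nothing k r ds)) cs cs′ →
                Step S (logN (sizes (node i km rm cs ∷ rs))) 1
                       ((node i km rm cs′ ∷ rs) ∷ S₀)
    delete-other-tree : ∀ {S m rs rs′ S₀ e k r ds} →
                S ↭ (m ∷ rs) ∷ S₀ →
                InList (Replace (node (just e) k r ds) (node nothing k r ds)) rs rs′ →
                Step S (logN (sizes (m ∷ rs))) 1 ((m ∷ rs′) ∷ S₀)
    -- delete of the item in the minimum node (covers delete-min)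
    delete-min : ∀ {S e k r cs rs S₀ ts dc ts′ lc h′} →
                S ↭ (node (just e) k r cs ∷ rs) ∷ S₀ →
                Destroy (node nothing k r cs ∷ rs) ts dc →
                Link ts ts′ lc →
                MinFirst ts′ h′ →
                Step S (logN (sizes (node (just e) k r cs ∷ rs)))
                       (suc (length rs) + dc + length ts + lc + length ts′ + maxRank ts′)
                       (h′ ∷ S₀)

  data Run : State → State → ℕ → ℕ → Set where
    done : ∀ {S} → Run S S 0 0
    step : ∀ {S b a S′ S″ A B} → Step S b a S′ → Run S′ S″ A B →
           Run S S″ (a + A) (budget b + B)

module Submission where

open import Defs
open import Level using (0ℓ)
open import Relation.Binary.Bundles using (TotalOrder)
open import Data.Nat using (ℕ; _≤_; _*_)
open import Data.List using ([])
open import Data.Product using (Σ)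

open import Data.Nat using (suc; _+_; _∸_; _<_; _^_; _≟_; ⌊_/2⌋; z≤n; s≤s; s≤s⁻¹)
open import Data.Nat.Properties
open import Algebra.Properties.CommutativeSemigroup +-commutativeSemigroup using (xy∙z≈xz∙y)
open import Data.Nat.Logarithm using (⌊log₂_⌋; ⌊log₂⌋-mono-≤; ⌊log₂[2^n]⌋≡n)
open import Data.Nat.ListAction using (sum)
open import Data.Nat.ListAction.Properties using (sum-↭)
open import Data.Nat.Tactic.RingSolver using (solve-∀)
open import Data.Maybe using (just; nothing)
open import Data.List using (List; _∷_; _++_; length; map; take; drop; downFrom)
open import Data.List.Properties using (length-++; length-map; length-downFrom; length-take; drop-map; take++drop≡id; ++-identityʳ)
open import Data.List.Relation.Unary.All as All using (All; []; _∷_)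
open import Data.List.Relation.Unary.All.Properties using (++⁺; ++⁻ˡ; ++⁻ʳ)
open import Data.List.Relation.Unary.AllPairs using (_∷_)
open import Data.List.Relation.Unary.Unique.Propositional using (Unique)
open import Data.List.Relation.Binary.Permutation.Propositional as ↭ using (_↭_; ↭-sym; ↭-trans; ↭-reflexive)
open import Data.List.Relation.Binary.Permutation.Propositional.Properties using (↭-length; All-resp-↭; shift; ++-comm; map⁺)
open import Data.Product using (_,_)
open import Relation.Binary.PropositionalEquality
open import Relation.Nullary using (yes; no)

-- Give every root 3 credits and every hollow node 3 credits per child.  An
-- operation other than delete costs 1 and adds at most 9 credits: a
-- decrease-key leaves a hollow node with at most two children behind and
-- creates one root.  Making a full node of rank r hollow costs 3r credits.  In
-- delete-min, a destroyed hollow root pays out of its own credits both for its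
-- destruction and for its children becoming roots; each ranked link uses up
-- the credits of a root; what remains is bounded by the number of distinct
-- ranks.  Ranks are logarithmic: a full node of rank r has children of ranks
-- r - 1, ..., 0 and a hollow node keeps its first two children, so a tree whose
-- root has rank r has at least minSize r ≥ 2 ^ ⌊ r /2⌋ nodes.

open ≤-Reasoning

+-insertˡ : ∀ a b c {d e} → b + d ≡ c + e → (a + b) + d ≡ (a + c) + e
+-insertˡ a b c {d} {e} eq = begin-equality
  (a + b) + d ≡⟨ +-assoc a b d ⟩
  a + (b + d) ≡⟨ cong (a +_) eq ⟩
  a + (c + e) ≡⟨ +-assoc a c e ⟨
  (a + c) + e ∎

+-insertʳ : ∀ a b c {d e} → b + d ≡ c + e → (b + a) + d ≡ (c + a) + e
+-insertʳ a b c {d} {e} eq = begin-equality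
  (b + a) + d ≡⟨ cong (_+ d) (+-comm b a) ⟩
  (a + b) + d ≡⟨ +-insertˡ a b c eq ⟩
  (a + c) + e ≡⟨ cong (_+ e) (+-comm a c) ⟩
  (c + a) + e ∎

frame-≤ : ∀ a x′ p y {x k} → x ≡ p + y → a + x′ ≤ p + k → a + (x′ + y) ≤ x + k
frame-≤ a x′ p y {k = k} refl le = begin
  a + (x′ + y) ≡⟨ +-assoc a x′ y ⟨
  a + x′ + y   ≤⟨ +-monoˡ-≤ y le ⟩
  p + k + y    ≡⟨ xy∙z≈xz∙y p k y ⟩
  p + y + k    ∎

remove : ℕ → List ℕ → List ℕ
remove m [] = []
remove m (x ∷ xs) with x ≟ m
... | yes _ = xs
... | no  _ = x ∷ remove m xs

length≤1+length-remove : ∀ m xs → length xs ≤ suc (length (remove m xs))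
length≤1+length-remove m [] = z≤n
length≤1+length-remove m (x ∷ xs) with x ≟ m
... | yes _ = ≤-refl
... | no  _ = s≤s (length≤1+length-remove m xs)

remove⁺ : ∀ {P : ℕ → Set} m {xs} → All P xs → All P (remove m xs)
remove⁺ m {[]} ps = ps
remove⁺ m {x ∷ xs} (p ∷ ps) with x ≟ m
... | yes _ = ps
... | no  _ = p ∷ remove⁺ m ps

remove-Unique : ∀ m {xs} → Unique xs → Unique (remove m xs)
remove-Unique m {[]} u = u
remove-Unique m {x ∷ xs} (x∉xs ∷ u) with x ≟ m
... | yes _ = u
... | no  _ = remove⁺ m x∉xs ∷ remove-Unique m u

remove-max : ∀ m {xs} → Unique xs → All (_< suc m) xs → All (_< m) (remove m xs)
remove-max m {[]} _ _ = []
remove-max m {x ∷ xs} (x∉xs ∷ u) (x<1+m ∷ xs<1+m) with x ≟ m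
... | yes refl = All.zipWith (λ (y<1+x , x≢y) → ≤∧≢⇒< (s≤s⁻¹ y<1+x) (≢-sym x≢y)) (xs<1+m , x∉xs)
... | no  x≢m  = ≤∧≢⇒< (s≤s⁻¹ x<1+m) x≢m ∷ remove-max m u xs<1+m

unique-bounded⇒length≤ : ∀ m {xs} → Unique xs → All (_< m) xs → length xs ≤ m
unique-bounded⇒length≤ 0 {[]} _ _ = z≤n
unique-bounded⇒length≤ 0 {x ∷ xs} _ (() ∷ _)
unique-bounded⇒length≤ (suc m) {xs} u xs<1+m = begin
  length xs                   ≤⟨ length≤1+length-remove m xs ⟩
  suc (length (remove m xs))  ≤⟨ s≤s (unique-bounded⇒length≤ m (remove-Unique m u) (remove-max m u xs<1+m)) ⟩
  suc m                       ∎

minSize : ℕ → ℕ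
minSize 0 = 1
minSize 1 = 2
minSize (suc (suc r)) = suc (minSize (suc r) + minSize r)

minSize≤minSize-suc : ∀ r → minSize r ≤ minSize (suc r)
minSize≤minSize-suc 0 = s≤s z≤n
minSize≤minSize-suc (suc r) = m≤n⇒m≤1+n (m≤m+n (minSize (suc r)) (minSize r))

2^⌊r/2⌋≤minSize : ∀ r → 2 ^ ⌊ r /2⌋ ≤ minSize r
2^⌊r/2⌋≤minSize 0 = ≤-refl
2^⌊r/2⌋≤minSize 1 = s≤s z≤n
2^⌊r/2⌋≤minSize (suc (suc r)) = m≤n⇒m≤1+n (+-mono-≤
  (≤-trans (2^⌊r/2⌋≤minSize r) (minSize≤minSize-suc r))
  (≤-trans (≤-reflexive (+-identityʳ _)) (2^⌊r/2⌋≤minSize r)))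

r≤1+2⌊r/2⌋ : ∀ r → r ≤ suc (2 * ⌊ r /2⌋)
r≤1+2⌊r/2⌋ 0 = z≤n
r≤1+2⌊r/2⌋ 1 = ≤-refl
r≤1+2⌊r/2⌋ (suc (suc r)) = begin
  suc (suc r)                    ≤⟨ s≤s (s≤s (r≤1+2⌊r/2⌋ r)) ⟩
  suc (suc (suc (2 * ⌊ r /2⌋)))  ≡⟨ cong suc (*-suc 2 ⌊ r /2⌋) ⟨
  suc (2 * suc ⌊ r /2⌋)          ∎

minSize≤⇒rank≤ : ∀ {r N} → minSize r ≤ N → r ≤ suc (2 * ⌊log₂ N ⌋)
minSize≤⇒rank≤ {r} {N} le = begin
  r                         ≤⟨ r≤1+2⌊r/2⌋ r ⟩
  suc (2 * ⌊ r /2⌋)         ≡⟨ cong (λ k → suc (2 * k)) (⌊log₂[2^n]⌋≡n ⌊ r /2⌋) ⟨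
  suc (2 * ⌊log₂ 2 ^ ⌊ r /2⌋ ⌋) ≤⟨ s≤s (*-monoʳ-≤ 2 (⌊log₂⌋-mono-≤ (≤-trans (2^⌊r/2⌋≤minSize r) le))) ⟩
  suc (2 * ⌊log₂ N ⌋)       ∎

rank-cost≤ : ∀ {r lg} → r ≤ suc (2 * lg) → suc (3 * r) ≤ 14 * suc lg
rank-cost≤ {r} {lg} r≤ = begin
  suc (3 * r)                              ≤⟨ s≤s (*-monoʳ-≤ 3 r≤) ⟩
  suc (3 * suc (2 * lg))                   ≤⟨ m≤m+n _ (8 * lg + 10) ⟩
  suc (3 * suc (2 * lg)) + (8 * lg + 10)   ≡⟨ expand lg ⟩
  14 * suc lg                              ∎
  where
  expand : ∀ lg → suc (3 * suc (2 * lg)) + (8 * lg + 10) ≡ 14 * suc lg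
  expand = solve-∀

delete-min-cost≤ : ∀ {r M n lg} → r ≤ suc (2 * lg) → M ≤ suc (2 * lg) → n ≤ suc M →
                   3 * r + M + 3 * n ≤ 14 * suc lg
delete-min-cost≤ {r} {M} {n} {lg} r≤ M≤ n≤ = begin
  3 * r + M + 3 * n                                                ≤⟨ +-mono-≤ (+-mono-≤ (*-monoʳ-≤ 3 r≤) M≤) (*-monoʳ-≤ 3 (≤-trans n≤ (s≤s M≤))) ⟩
  3 * suc (2 * lg) + suc (2 * lg) + 3 * suc (suc (2 * lg))         ≤⟨ m≤m+n _ 4 ⟩
  3 * suc (2 * lg) + suc (2 * lg) + 3 * suc (suc (2 * lg)) + 4     ≡⟨ expand lg ⟩
  14 * suc lg                                                      ∎
  where
  expand : ∀ lg → 3 * suc (2 * lg) + suc (2 * lg) + 3 * suc (suc (2 * lg)) + 4 ≡ 14 * suc lg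
  expand = solve-∀

module Amortization (O : TotalOrder 0ℓ 0ℓ 0ℓ) (Item : Set) where
  open HollowHeap O Item

  credit  : Tree → ℕ
  credits : List Tree → ℕ
  credit (node nothing  _ _ cs) = 3 * length cs + credits cs
  credit (node (just _) _ _ cs) = credits cs
  credits [] = 0
  credits (t ∷ ts) = credit t + credits ts

  potential : ℕ → List Tree → ℕ
  potential w ts = w * length ts + credits ts

  φ : Heap → ℕ
  φ = potential 3

  Φ : State → ℕ
  Φ S = sum (map φ S)

  credits≡sum : ∀ ts → credits ts ≡ sum (map credit ts)
  credits≡sum [] = refl
  credits≡sum (t ∷ ts) = cong (credit t +_) (credits≡sum ts)

  sizes≡sum : ∀ ts → sizes ts ≡ sum (map size ts)
  sizes≡sum [] = refl
  sizes≡sum (t ∷ ts) = cong (size t +_) (sizes≡sum ts)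

  credits-↭ : ∀ {xs ys} → xs ↭ ys → credits xs ≡ credits ys
  credits-↭ {xs} {ys} p = trans (credits≡sum xs) (trans (sum-↭ (map⁺ credit p)) (sym (credits≡sum ys)))

  sizes-↭ : ∀ {xs ys} → xs ↭ ys → sizes xs ≡ sizes ys
  sizes-↭ {xs} {ys} p = trans (sizes≡sum xs) (trans (sum-↭ (map⁺ size p)) (sym (sizes≡sum ys)))

  credits-++ : ∀ xs ys → credits (xs ++ ys) ≡ credits xs + credits ys
  credits-++ [] ys = refl
  credits-++ (x ∷ xs) ys = trans (cong (credit x +_) (credits-++ xs ys)) (sym (+-assoc (credit x) _ _))

  sizes-++ : ∀ xs ys → sizes (xs ++ ys) ≡ sizes xs + sizes ys
  sizes-++ [] ys = refl
  sizes-++ (x ∷ xs) ys = trans (cong (size x +_) (sizes-++ xs ys)) (sym (+-assoc (size x) _ _))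

  potential-↭ : ∀ w {xs ys} → xs ↭ ys → potential w xs ≡ potential w ys
  potential-↭ w p = cong₂ _+_ (cong (w *_) (↭-length p)) (credits-↭ p)

  potential-++ : ∀ w xs ys → potential w (xs ++ ys) ≡ potential w xs + potential w ys
  potential-++ w xs ys = begin-equality
    w * length (xs ++ ys) + credits (xs ++ ys)
      ≡⟨ cong₂ _+_ (cong (w *_) (length-++ xs)) (credits-++ xs ys) ⟩
    w * (length xs + length ys) + (credits xs + credits ys)
      ≡⟨ distrib w (length xs) (length ys) (credits xs) (credits ys) ⟩
    (w * length xs + credits xs) + (w * length ys + credits ys) ∎
    where
    distrib : ∀ w m n a b → w * (m + n) + (a + b) ≡ (w * m + a) + (w * n + b)
    distrib = solve-∀

  Φ-↭ : ∀ {S h S₀} → S ↭ h ∷ S₀ → Φ S ≡ φ h + Φ S₀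
  Φ-↭ p = sum-↭ (map⁺ φ p)

  local-amortized : ∀ a {S h S₀} h′ {K} → S ↭ h ∷ S₀ → a + φ h′ ≤ φ h + K → a + Φ (h′ ∷ S₀) ≤ Φ S + K
  local-amortized a {h = h} {S₀} h′ p = frame-≤ a (φ h′) (φ h) (Φ S₀) (Φ-↭ p)

  data WellRanked : Tree → Set where
    ranked-full   : ∀ {e k r cs} → All WellRanked cs → map rank cs ≡ downFrom r →
                    WellRanked (node (just e) k r cs)
    ranked-hollow : ∀ {k r cs} → All WellRanked cs → take 2 (map rank cs) ≡ take 2 (downFrom r) →
                    WellRanked (node nothing k r cs)

  ranks≡downFrom⇒length≡ : ∀ {r} cs → map rank cs ≡ downFrom r → length cs ≡ r
  ranks≡downFrom⇒length≡ {r} cs q = trans (sym (length-map rank cs)) (trans (cong length q) (length-downFrom r))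

  full-ranks : ∀ {e k r cs} → WellRanked (node (just e) k r cs) → map rank cs ≡ downFrom r
  full-ranks (ranked-full _ q) = q

  full-length≡rank : ∀ {e k r cs} → WellRanked (node (just e) k r cs) → length cs ≡ r
  full-length≡rank {cs = cs} w = ranks≡downFrom⇒length≡ cs (full-ranks w)

  hollow-WellRanked : ∀ {e k r cs} → WellRanked (node (just e) k r cs) → WellRanked (node nothing k r cs)
  hollow-WellRanked (ranked-full wcs q) = ranked-hollow wcs (cong (take 2) q)

  minSize≤1+sizes : ∀ r cs → All (λ c → minSize (rank c) ≤ size c) cs →
                    take 2 (map rank cs) ≡ take 2 (downFrom r) → minSize r ≤ suc (sizes cs)
  minSize≤1+sizes 0 cs _ _ = s≤s z≤n
  minSize≤1+sizes 1 (node _ _ _ _ ∷ cs) _ _ = s≤s (s≤s z≤n)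
  minSize≤1+sizes (suc (suc r)) (node _ _ _ _ ∷ node _ _ _ _ ∷ cs) (le₁ ∷ le₂ ∷ _) refl =
    s≤s (+-mono-≤ le₁ (≤-trans le₂ (m≤m+n _ (sizes cs))))

  minSize≤size  : ∀ {t} → WellRanked t → minSize (rank t) ≤ size t
  minSize≤sizes : ∀ {ts} → All WellRanked ts → All (λ c → minSize (rank c) ≤ size c) ts
  minSize≤size (ranked-full {r = r} {cs} wcs q) = minSize≤1+sizes r cs (minSize≤sizes wcs) (cong (take 2) q)
  minSize≤size (ranked-hollow {r = r} {cs} wcs q) = minSize≤1+sizes r cs (minSize≤sizes wcs) q
  minSize≤sizes [] = []
  minSize≤sizes (wc ∷ wcs) = minSize≤size wc ∷ minSize≤sizes wcs

  rank≤ : ∀ {t N} → WellRanked t → size t ≤ N → rank t ≤ suc (2 * ⌊log₂ N ⌋)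
  rank≤ wt le = minSize≤⇒rank≤ (≤-trans (minSize≤size wt) le)

  maxRank≤ : ∀ {N} ts → All WellRanked ts → sizes ts ≤ N → maxRank ts ≤ suc (2 * ⌊log₂ N ⌋)
  maxRank≤ [] _ _ = z≤n
  maxRank≤ (t ∷ ts) (wt ∷ wts) le =
    ⊔-lub (rank≤ wt (≤-trans (m≤m+n _ _) le)) (maxRank≤ ts wts (≤-trans (m≤n+m _ _) le))

  ranks≤maxRank : ∀ ts → All (_≤ maxRank ts) (map rank ts)
  ranks≤maxRank [] = []
  ranks≤maxRank (t ∷ ts) = m≤m⊔n (rank t) (maxRank ts) ∷ All.map (λ le → ≤-trans le (m≤n⊔m (rank t) _)) (ranks≤maxRank ts)

  length≤1+maxRank : ∀ ts → Unique (map rank ts) → length ts ≤ suc (maxRank ts)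
  length≤1+maxRank ts u = begin
    length ts            ≡⟨ length-map rank ts ⟨
    length (map rank ts) ≤⟨ unique-bounded⇒length≤ (suc (maxRank ts)) u (All.map s≤s (ranks≤maxRank ts)) ⟩
    suc (maxRank ts)     ∎

  InList-length : ∀ {R xs ys} → InList R xs ys → length ys ≡ length xs
  InList-length (hd _) = refl
  InList-length (tl il) = cong suc (InList-length il)

  replace-credit  : ∀ {u u′ t t′} → Replace u u′ t t′ → credit t′ + credit u ≡ credit t + credit u′
  replace-credits : ∀ {u u′ xs ys} → InList (Replace u u′) xs ys → credits ys + credit u ≡ credits xs + credit u′
  replace-credit {u} {u′} here = +-comm (credit u′) (credit u)
  replace-credit (there {i = nothing} {cs = cs} {cs′} il) rewrite InList-length il =
    +-insertˡ (3 * length cs) (credits cs′) (credits cs) (replace-credits il)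
  replace-credit (there {i = just _} il) = replace-credits il
  replace-credits (hd {t} {t′} {ts} r) = +-insertʳ (credits ts) (credit t′) (credit t) (replace-credit r)
  replace-credits (tl {t} {ts} {ts′} il) = +-insertˡ (credit t) (credits ts′) (credits ts) (replace-credits il)

  replace-potential : ∀ w {u u′ xs ys} → InList (Replace u u′) xs ys →
                      potential w ys + credit u ≡ potential w xs + credit u′
  replace-potential w {xs = xs} {ys} il rewrite InList-length il =
    +-insertˡ (w * length xs) (credits ys) (credits xs) (replace-credits il)

  replace-size  : ∀ {u u′ t t′} → Replace u u′ t t′ → size u ≤ size t
  replace-sizes : ∀ {u u′ xs ys} → InList (Replace u u′) xs ys → size u ≤ sizes xs
  replace-size here = ≤-refl
  replace-size (there il) = m≤n⇒m≤1+n (replace-sizes il)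
  replace-sizes (hd r) = ≤-trans (replace-size r) (m≤m+n _ _)
  replace-sizes (tl il) = ≤-trans (replace-sizes il) (m≤n+m _ _)

  replace-ranks : ∀ {u u′ xs ys} → InList (Replace u u′) xs ys → rank u′ ≡ rank u → map rank ys ≡ map rank xs
  replace-ranks (hd here) eq = cong (_∷ _) eq
  replace-ranks (hd (there _)) _ = refl
  replace-ranks (tl {t} il) eq = cong (rank t ∷_) (replace-ranks il eq)

  replace-WellRanked⁻ : ∀ {u u′ t t′} → Replace u u′ t t′ → WellRanked t → WellRanked u
  replace-All-WellRanked⁻ : ∀ {u u′ xs ys} → InList (Replace u u′) xs ys → All WellRanked xs → WellRanked u
  replace-WellRanked⁻ here wt = wt
  replace-WellRanked⁻ (there il) (ranked-full wcs _) = replace-All-WellRanked⁻ il wcs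
  replace-WellRanked⁻ (there il) (ranked-hollow wcs _) = replace-All-WellRanked⁻ il wcs
  replace-All-WellRanked⁻ (hd r) (wt ∷ _) = replace-WellRanked⁻ r wt
  replace-All-WellRanked⁻ (tl il) (_ ∷ wts) = replace-All-WellRanked⁻ il wts

  replace-WellRanked⁺ : ∀ {u u′ t t′} → Replace u u′ t t′ → rank u′ ≡ rank u →
                       WellRanked u′ → WellRanked t → WellRanked t′
  replace-All-WellRanked⁺ : ∀ {u u′ xs ys} → InList (Replace u u′) xs ys → rank u′ ≡ rank u →
                            WellRanked u′ → All WellRanked xs → All WellRanked ys
  replace-WellRanked⁺ here _ wu′ _ = wu′
  replace-WellRanked⁺ (there il) eq wu′ (ranked-full wcs q) =
    ranked-full (replace-All-WellRanked⁺ il eq wu′ wcs) (trans (replace-ranks il eq) q)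
  replace-WellRanked⁺ (there il) eq wu′ (ranked-hollow wcs q) =
    ranked-hollow (replace-All-WellRanked⁺ il eq wu′ wcs) (trans (cong (take 2) (replace-ranks il eq)) q)
  replace-All-WellRanked⁺ (hd r) eq wu′ (wt ∷ wts) = replace-WellRanked⁺ r eq wu′ wt ∷ wts
  replace-All-WellRanked⁺ (tl il) eq wu′ (wt ∷ wts) = wt ∷ replace-All-WellRanked⁺ il eq wu′ wts

  meld-↭ : ∀ {h₁ h₂ h} → Meld h₁ h₂ h → h ↭ h₁ ++ h₂
  meld-↭ emptyˡ = ↭.refl
  meld-↭ emptyʳ = ↭-reflexive (sym (++-identityʳ _))
  meld-↭ (left _ p) = ↭.prep _ p
  meld-↭ (right {m₁} {r₁} {m₂} {r₂} _ p) = ↭-trans (↭.prep m₂ p) (↭-sym (shift m₂ (m₁ ∷ r₁) r₂))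

  meld-φ : ∀ {h₁ h₂ h} → Meld h₁ h₂ h → φ h ≡ φ h₁ + φ h₂
  meld-φ {h₁} {h₂} m = trans (potential-↭ 3 (meld-↭ m)) (potential-++ 3 h₁ h₂)

  meld-WellRanked : ∀ {h₁ h₂ h} → Meld h₁ h₂ h → All WellRanked h₁ → All WellRanked h₂ → All WellRanked h
  meld-WellRanked m w₁ w₂ = All-resp-↭ (↭-sym (meld-↭ m)) (++⁺ w₁ w₂)

  rankedLink-credit : ∀ {t₁ t₂ t} → RankedLink t₁ t₂ t → credit t ≡ credit t₁ + credit t₂
  rankedLink-credit (win₁ {cs₁ = cs₁} {cs₂ = cs₂} _) = +-comm (credits cs₂) (credits cs₁)
  rankedLink-credit (win₂ _) = refl

  rankedLink-size : ∀ {t₁ t₂ t} → RankedLink t₁ t₂ t → size t ≡ size t₁ + size t₂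
  rankedLink-size (win₁ {cs₁ = cs₁} {cs₂ = cs₂} _) = cong suc (+-comm (suc (sizes cs₂)) (sizes cs₁))
  rankedLink-size (win₂ {cs₁ = cs₁} {cs₂ = cs₂} _) = cong suc (sym (+-suc (sizes cs₁) (sizes cs₂)))

  rankedLink-WellRanked : ∀ {t₁ t₂ t} → RankedLink t₁ t₂ t → WellRanked t₁ → WellRanked t₂ → WellRanked t
  rankedLink-WellRanked (win₁ _) (ranked-full wcs₁ q₁) w₂ = ranked-full (w₂ ∷ wcs₁) (cong (_ ∷_) q₁)
  rankedLink-WellRanked (win₂ _) w₁ (ranked-full wcs₂ q₂) = ranked-full (w₁ ∷ wcs₂) (cong (_ ∷_) q₂)

  link-length : ∀ {ts ts′ c} → Link ts ts′ c → c + length ts′ ≡ length ts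
  link-length (stop _) = refl
  link-length (link p _ l) = trans (cong suc (link-length l)) (sym (↭-length p))

  link-credits : ∀ {ts ts′ c} → Link ts ts′ c → credits ts′ ≡ credits ts
  link-credits (stop _) = refl
  link-credits (link {t₁ = t₁} {t₂} {os} {t} p rl l) = begin-equality
    _                                ≡⟨ link-credits l ⟩
    credit t + credits os            ≡⟨ cong (_+ credits os) (rankedLink-credit rl) ⟩
    credit t₁ + credit t₂ + credits os ≡⟨ +-assoc (credit t₁) (credit t₂) (credits os) ⟩
    credits (t₁ ∷ t₂ ∷ os)           ≡⟨ credits-↭ p ⟨
    _                                ∎

  link-sizes : ∀ {ts ts′ c} → Link ts ts′ c → sizes ts′ ≡ sizes ts
  link-sizes (stop _) = refl
  link-sizes (link {t₁ = t₁} {t₂} {os} {t} p rl l) = begin-equality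
    _                              ≡⟨ link-sizes l ⟩
    size t + sizes os              ≡⟨ cong (_+ sizes os) (rankedLink-size rl) ⟩
    size t₁ + size t₂ + sizes os   ≡⟨ +-assoc (size t₁) (size t₂) (sizes os) ⟩
    sizes (t₁ ∷ t₂ ∷ os)           ≡⟨ sizes-↭ p ⟨
    _                              ∎

  link-WellRanked : ∀ {ts ts′ c} → Link ts ts′ c → All WellRanked ts → All WellRanked ts′
  link-WellRanked (stop _) wts = wts
  link-WellRanked (link p rl l) wts with All-resp-↭ p wts
  ... | w₁ ∷ w₂ ∷ wos = link-WellRanked l (rankedLink-WellRanked rl w₁ w₂ ∷ wos)

  link-unique : ∀ {ts ts′ c} → Link ts ts′ c → Unique (map rank ts′)
  link-unique (stop u) = u
  link-unique (link _ _ l) = link-unique l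

  -- Roots are charged only 2 credits here; the third is kept for the linking
  -- phase.  Of the 3 credits per child of a destroyed hollow root, 2 turn the
  -- child into a root and 1 pays for visiting it; the root's own 2 credits pay
  -- for destroying it.
  destroy-cost : ∀ {ts ts′ dc} → Destroy ts ts′ dc → dc + potential 2 ts′ ≤ potential 2 ts
  destroy-cost (stop _) = ≤-refl
  destroy-cost {ts} (destroy {k = k} {r} {cs} {os} {ts′} {c} p d) = begin
    suc (length cs) + c + potential 2 ts′                    ≡⟨ +-assoc (suc (length cs)) c _ ⟩
    suc (length cs) + (c + potential 2 ts′)                  ≤⟨ +-monoʳ-≤ (suc (length cs)) (destroy-cost d) ⟩
    suc (length cs) + potential 2 (cs ++ os)                 ≡⟨ cong (suc (length cs) +_) (potential-++ 2 cs os) ⟩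
    suc (length cs) + (potential 2 cs + potential 2 os)      ≤⟨ release (length cs) (credits cs) (length os) (credits os) ⟩
    potential 2 (node nothing k r cs ∷ os)                   ≡⟨ potential-↭ 2 p ⟨
    potential 2 ts                                           ∎
    where
    expand : ∀ L C n c → suc (suc L + ((2 * L + C) + (2 * n + c))) ≡ 2 * suc n + ((3 * L + C) + c)
    expand = solve-∀
    release : ∀ L C n c → suc L + ((2 * L + C) + (2 * n + c)) ≤ 2 * suc n + ((3 * L + C) + c)
    release L C n c = ≤-trans (n≤1+n _) (≤-reflexive (expand L C n c))

  destroy-sizes : ∀ {ts ts′ dc} → Destroy ts ts′ dc → sizes ts′ ≤ sizes ts
  destroy-sizes (stop _) = ≤-refl
  destroy-sizes (destroy {k = k} {r} {cs} {os} p d) = begin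
    _                                  ≤⟨ destroy-sizes d ⟩
    sizes (cs ++ os)                   ≡⟨ sizes-++ cs os ⟩
    sizes cs + sizes os                ≤⟨ n≤1+n _ ⟩
    sizes (node nothing k r cs ∷ os)   ≡⟨ sizes-↭ p ⟨
    _                                  ∎

  destroy-WellRanked : ∀ {ts ts′ dc} → Destroy ts ts′ dc → All WellRanked ts → All WellRanked ts′
  destroy-WellRanked (stop _) wts = wts
  destroy-WellRanked (destroy p d) wts with All-resp-↭ p wts
  ... | ranked-hollow wcs _ ∷ wos = destroy-WellRanked d (++⁺ wcs wos)

  minFirst-↭ : ∀ {ts h} → MinFirst ts h → h ↭ ts
  minFirst-↭ empty = ↭.refl
  minFirst-↭ (pick p _) = p

  keep++move : ∀ r cs → keepChildren r cs ++ moveChildren r cs ≡ cs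
  keep++move 0 cs = ++-identityʳ cs
  keep++move 1 cs = ++-identityʳ cs
  keep++move 2 cs = ++-identityʳ cs
  keep++move (suc (suc (suc _))) cs = take++drop≡id 2 cs

  keep-ranks : ∀ r cs → take 2 (map rank (keepChildren r cs)) ≡ take 2 (map rank cs)
  keep-ranks 0 cs = refl
  keep-ranks 1 cs = refl
  keep-ranks 2 cs = refl
  keep-ranks (suc (suc (suc _))) [] = refl
  keep-ranks (suc (suc (suc _))) (c ∷ []) = refl
  keep-ranks (suc (suc (suc _))) (c₁ ∷ c₂ ∷ cs) = refl

  move-ranks : ∀ r cs → map rank cs ≡ downFrom r → map rank (moveChildren r cs) ≡ downFrom (r ∸ 2)
  move-ranks 0 cs _ = refl
  move-ranks 1 cs _ = refl
  move-ranks 2 cs _ = refl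
  move-ranks (suc (suc (suc _))) cs q = trans (sym (drop-map 2 cs)) (cong (drop 2) q)

  keep-length : ∀ r cs → map rank cs ≡ downFrom r → length (keepChildren r cs) ≤ 2
  keep-length 0 cs q = ≤-trans (≤-reflexive (ranks≡downFrom⇒length≡ cs q)) z≤n
  keep-length 1 cs q = ≤-trans (≤-reflexive (ranks≡downFrom⇒length≡ cs q)) (s≤s z≤n)
  keep-length 2 cs q = ≤-reflexive (ranks≡downFrom⇒length≡ cs q)
  keep-length (suc (suc (suc _))) cs _ = ≤-trans (≤-reflexive (length-take 2 cs)) (m⊓n≤m 2 _)

  keep-WellRanked : ∀ {k} r {cs} → All WellRanked cs → map rank cs ≡ downFrom r →
                    WellRanked (node nothing k r (keepChildren r cs))
  keep-WellRanked r {cs} wcs q = ranked-hollow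
    (++⁻ˡ (keepChildren r cs) (subst (All WellRanked) (sym (keep++move r cs)) wcs))
    (trans (keep-ranks r cs) (cong (take 2) q))

  move-WellRanked : ∀ {e k} r {cs} → All WellRanked cs → map rank cs ≡ downFrom r →
                    WellRanked (node (just e) k (r ∸ 2) (moveChildren r cs))
  move-WellRanked r {cs} wcs q = ranked-full
    (++⁻ʳ (keepChildren r cs) (subst (All WellRanked) (sym (keep++move r cs)) wcs))
    (move-ranks r cs q)

  decrease-key-φ : ∀ {h h₀ h′ e k₀ k r cs} → map rank cs ≡ downFrom r →
    InList (Replace (node (just e) k₀ r cs) (node nothing k₀ r (keepChildren r cs))) h h₀ →
    Meld h₀ (node (just e) k (r ∸ 2) (moveChildren r cs) ∷ []) h′ →
    φ h′ ≤ φ h + 9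
  decrease-key-φ {h} {h₀} {h′} {r = r} {cs} q il m = +-cancelʳ-≤ K (φ h′) (φ h + 9) (begin
    φ h′ + K                        ≡⟨ cong (_+ K) (meld-φ m) ⟩
    φ h₀ + (3 * 1 + (M + 0)) + K    ≡⟨ regroup (φ h₀) K M ⟩
    φ h₀ + (K + M) + 3              ≡⟨ cong (λ c → φ h₀ + c + 3) split ⟨
    φ h₀ + credits cs + 3           ≡⟨ cong (_+ 3) (replace-potential 3 il) ⟩
    φ h + (3 * L + K) + 3           ≤⟨ +-monoˡ-≤ 3 (+-monoʳ-≤ (φ h) (+-monoˡ-≤ K (*-monoʳ-≤ 3 (keep-length r cs q)))) ⟩
    φ h + (3 * 2 + K) + 3           ≡⟨ regroup′ (φ h) K ⟩
    φ h + 9 + K                     ∎)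
    where
    K M L : ℕ
    K = credits (keepChildren r cs)
    M = credits (moveChildren r cs)
    L = length (keepChildren r cs)
    split : credits cs ≡ K + M
    split = trans (cong credits (sym (keep++move r cs))) (credits-++ (keepChildren r cs) (moveChildren r cs))
    regroup : ∀ x K M → x + (3 * 1 + (M + 0)) + K ≡ x + (K + M) + 3
    regroup = solve-∀
    regroup′ : ∀ x K → x + (3 * 2 + K) + 3 ≡ x + 9 + K
    regroup′ = solve-∀

  make-hollow-φ : ∀ {h h′ e k r ds} →
    InList (Replace (node (just e) k r ds) (node nothing k r ds)) h h′ → φ h′ ≡ φ h + 3 * length ds
  make-hollow-φ {h} {h′} {ds = ds} il = +-cancelʳ-≡ (credits ds) (φ h′) (φ h + 3 * length ds)
    (trans (replace-potential 3 il) (sym (+-assoc (φ h) (3 * length ds) (credits ds))))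

  make-hollow-WellRanked : ∀ {h h′ e k r ds} →
    InList (Replace (node (just e) k r ds) (node nothing k r ds)) h h′ → All WellRanked h → All WellRanked h′
  make-hollow-WellRanked il wh = replace-All-WellRanked⁺ il refl (hollow-WellRanked (replace-All-WellRanked⁻ il wh)) wh

  make-hollow-amortized : ∀ {S h S₀ h′ e k r ds} → S ↭ h ∷ S₀ →
    InList (Replace (node (just e) k r ds) (node nothing k r ds)) h h′ → All (All WellRanked) S →
    1 + Φ (h′ ∷ S₀) ≤ Φ S + 14 * suc ⌊log₂ sizes h ⌋
  make-hollow-amortized {h = h} {h′ = h′} {e} {k} {r} {ds} p il ws = local-amortized 1 h′ p (begin
    1 + φ h′                        ≡⟨ cong suc (make-hollow-φ il) ⟩
    suc (φ h + 3 * length ds)       ≡⟨ +-suc (φ h) _ ⟨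
    φ h + suc (3 * length ds)       ≤⟨ +-monoʳ-≤ (φ h) (rank-cost≤ length≤) ⟩
    φ h + 14 * suc ⌊log₂ sizes h ⌋  ∎)
    where
    wu : WellRanked (node (just e) k r ds)
    wu = replace-All-WellRanked⁻ il (All.head (All-resp-↭ p ws))
    length≤ : length ds ≤ suc (2 * ⌊log₂ sizes h ⌋)
    length≤ = subst (_≤ _) (sym (full-length≡rank wu)) (rank≤ wu (replace-sizes il))

  delete-min-φ : ∀ {e k r cs rs ts dc ts′ lc h′} →
    Destroy (node nothing k r cs ∷ rs) ts dc → Link ts ts′ lc → MinFirst ts′ h′ →
    suc (length rs) + dc + length ts + lc + length ts′ + maxRank ts′ + φ h′
      ≤ φ (node (just e) k r cs ∷ rs) + (3 * length cs + maxRank ts′ + 3 * length ts′)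
  delete-min-φ {cs = cs} {rs} {ts} {dc} {ts′} {lc} {h′} d l mf = ≤-trans
    (≤-reflexive (cong (suc (length rs) + dc + length ts + lc + length ts′ + maxRank ts′ +_) φh′≡))
    (account (length rs) dc (length ts) lc (length ts′) (maxRank ts′) (credits ts)
             (length cs) (credits cs) (credits rs) (link-length l) (destroy-cost d))
    where
    φh′≡ : φ h′ ≡ 3 * length ts′ + credits ts
    φh′≡ = trans (potential-↭ 3 (minFirst-↭ mf)) (cong (3 * length ts′ +_) (link-credits l))
    account : ∀ R dc n lc n′ M c L Ccs Crs → lc + n′ ≡ n →
              dc + (2 * n + c) ≤ 2 * suc R + ((3 * L + Ccs) + Crs) →
              suc R + dc + n + lc + n′ + M + (3 * n′ + c) ≤ 3 * suc R + (Ccs + Crs) + (3 * L + M + 3 * n′)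
    account R dc _ lc n′ M c L Ccs Crs refl destroyed = begin
      suc R + dc + (lc + n′) + lc + n′ + M + (3 * n′ + c)           ≡⟨ regroup R dc lc n′ M c ⟩
      dc + (2 * (lc + n′) + c) + (suc R + M + 3 * n′)              ≤⟨ +-monoˡ-≤ _ destroyed ⟩
      2 * suc R + ((3 * L + Ccs) + Crs) + (suc R + M + 3 * n′)    ≡⟨ regroup′ R M n′ L Ccs Crs ⟩
      3 * suc R + (Ccs + Crs) + (3 * L + M + 3 * n′)               ∎
      where
      regroup : ∀ R dc lc n′ M c → suc R + dc + (lc + n′) + lc + n′ + M + (3 * n′ + c)
                                   ≡ dc + (2 * (lc + n′) + c) + (suc R + M + 3 * n′)
      regroup = solve-∀
      regroup′ : ∀ R M n′ L Ccs Crs → 2 * suc R + ((3 * L + Ccs) + Crs) + (suc R + M + 3 * n′)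
                                      ≡ 3 * suc R + (Ccs + Crs) + (3 * L + M + 3 * n′)
      regroup′ = solve-∀

  delete-min-WellRanked : ∀ {e k r cs rs ts dc ts′ lc} → WellRanked (node (just e) k r cs) →
    All WellRanked rs → Destroy (node nothing k r cs ∷ rs) ts dc → Link ts ts′ lc → All WellRanked ts′
  delete-min-WellRanked wu wrs d l = link-WellRanked l (destroy-WellRanked d (hollow-WellRanked wu ∷ wrs))

  delete-min-amortized : ∀ {S e k r cs rs S₀ ts dc ts′ lc h′} → S ↭ (node (just e) k r cs ∷ rs) ∷ S₀ →
    Destroy (node nothing k r cs ∷ rs) ts dc → Link ts ts′ lc → MinFirst ts′ h′ → All (All WellRanked) S →
    suc (length rs) + dc + length ts + lc + length ts′ + maxRank ts′ + Φ (h′ ∷ S₀)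
      ≤ Φ S + 14 * suc ⌊log₂ sizes (node (just e) k r cs ∷ rs) ⌋
  delete-min-amortized {e = e} {k} {r} {cs} {rs} {ts = ts} {dc} {ts′} {lc} {h′} p d l mf ws =
    local-amortized (suc (length rs) + dc + length ts + lc + length ts′ + maxRank ts′) h′ p
      (≤-trans (delete-min-φ {e = e} d l mf)
               (+-monoʳ-≤ (φ h) (delete-min-cost≤ length-cs≤ maxRank-ts′≤ length-ts′≤)))
    where
    h : Heap
    h = node (just e) k r cs ∷ rs
    wh : All WellRanked h
    wh = All.head (All-resp-↭ p ws)
    wu : WellRanked (node (just e) k r cs)
    wu = All.head wh
    length-cs≤ : length cs ≤ suc (2 * ⌊log₂ sizes h ⌋)
    length-cs≤ = subst (_≤ _) (sym (full-length≡rank wu)) (rank≤ wu (m≤m+n _ (sizes rs)))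
    maxRank-ts′≤ : maxRank ts′ ≤ suc (2 * ⌊log₂ sizes h ⌋)
    maxRank-ts′≤ = maxRank≤ ts′ (delete-min-WellRanked wu (All.tail wh) d l)
                     (≤-trans (≤-reflexive (link-sizes l)) (destroy-sizes d))
    length-ts′≤ : length ts′ ≤ suc (maxRank ts′)
    length-ts′≤ = length≤1+maxRank ts′ (link-unique l)

  decrease-key-root-φ : ∀ {m rs os h′ e k₀ k r cs} → rs ↭ node (just e) k₀ r cs ∷ os →
    Meld (m ∷ os) (node (just e) k r cs ∷ []) h′ → φ h′ ≡ φ (m ∷ rs)
  decrease-key-root-φ {m} {rs} {os} {h′} {e} {k₀} {r = r} {cs} q md = begin-equality
    φ h′                                         ≡⟨ meld-φ md ⟩
    φ (m ∷ os) + φ (node (just e) k₀ r cs ∷ [])  ≡⟨ potential-++ 3 (m ∷ os) _ ⟨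
    φ (m ∷ os ++ node (just e) k₀ r cs ∷ [])     ≡⟨ potential-↭ 3 (↭.prep m (↭-trans (++-comm os _) (↭-sym q))) ⟩
    φ (m ∷ rs)                                   ∎

  unit-cost≤ : ∀ p {x′} → x′ ≤ p + 9 → 1 + x′ ≤ p + 10
  unit-cost≤ p le = ≤-trans (s≤s le) (≤-reflexive (sym (+-suc p 9)))

  cheap-local : ∀ {S h S₀} h′ → S ↭ h ∷ S₀ → φ h′ ≤ φ h + 9 → 1 + Φ (h′ ∷ S₀) ≤ Φ S + 10
  cheap-local {h = h} h′ p le = local-amortized 1 h′ p (unit-cost≤ (φ h) le)

  cheap-amortized : ∀ {S a S′} → Step S cheap a S′ → All (All WellRanked) S → a + Φ S′ ≤ Φ S + 10
  cheap-amortized {S} make-heap _ = unit-cost≤ (Φ S) (m≤m+n (Φ S) 9)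
  cheap-amortized {S} (find-min _) _ = unit-cost≤ (Φ S) (m≤m+n (Φ S) 9)
  cheap-amortized (insert {h = h} {h′ = h′} _ _ _ p m) _ =
    cheap-local h′ p (≤-trans (≤-reflexive (meld-φ m)) (+-monoʳ-≤ (φ h) (m≤m+n 3 6)))
  cheap-amortized (meld {h₁ = h₁} {h₂} {S₀} {h} p m) _ =
    frame-≤ 1 (φ h) (φ h₁ + φ h₂) (Φ S₀) (trans (Φ-↭ p) (sym (+-assoc (φ h₁) (φ h₂) (Φ S₀))))
            (unit-cost≤ (φ h₁ + φ h₂) (≤-trans (≤-reflexive (meld-φ m)) (m≤m+n _ 9)))
  cheap-amortized (decrease-key-min {e = e} {r = r} {cs} {rs} k p _) _ =
    cheap-local (node (just e) k r cs ∷ rs) p (m≤m+n _ 9)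
  cheap-amortized (decrease-key-root {h′ = h′} _ p q _ m) _ =
    cheap-local h′ p (≤-trans (≤-reflexive (decrease-key-root-φ q m)) (m≤m+n _ 9))
  cheap-amortized (decrease-key {h′ = h′} _ p il _ m) ws = cheap-local h′ p
    (decrease-key-φ (full-ranks (replace-All-WellRanked⁻ il (All.head (All-resp-↭ p ws)))) il m)

  delete-amortized : ∀ {S N a S′} → Step S (logN N) a S′ → All (All WellRanked) S →
                     a + Φ S′ ≤ Φ S + 14 * budget (logN N)
  delete-amortized (delete-below-min p il) = make-hollow-amortized p (hd (there il))
  delete-amortized (delete-other-tree p il) = make-hollow-amortized p (tl il)
  delete-amortized (delete-min p d l mf) = delete-min-amortized p d l mf

  step-amortized : ∀ {S b a S′} → Step S b a S′ → All (All WellRanked) S → a + Φ S′ ≤ Φ S + 14 * budget b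
  step-amortized {b = cheap}  st ws = ≤-trans (cheap-amortized st ws) (+-monoʳ-≤ _ (m≤m+n 10 4))
  step-amortized {b = logN _} st ws = delete-amortized st ws

  step-WellRanked : ∀ {S b a S′} → Step S b a S′ → All (All WellRanked) S → All (All WellRanked) S′
  step-WellRanked make-heap ws = [] ∷ ws
  step-WellRanked (find-min _) ws = ws
  step-WellRanked (insert _ _ _ p m) ws with All-resp-↭ p ws
  ... | wh ∷ ws₀ = meld-WellRanked m wh (ranked-full [] refl ∷ []) ∷ ws₀
  step-WellRanked (meld p m) ws with All-resp-↭ p ws
  ... | wh₁ ∷ wh₂ ∷ ws₀ = meld-WellRanked m wh₁ wh₂ ∷ ws₀
  step-WellRanked (decrease-key-min _ p _) ws with All-resp-↭ p ws
  ... | (ranked-full wcs q ∷ wrs) ∷ ws₀ = (ranked-full wcs q ∷ wrs) ∷ ws₀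
  step-WellRanked (decrease-key-root _ p q _ m) ws with All-resp-↭ p ws
  ... | (wm ∷ wrs) ∷ ws₀ with All-resp-↭ q wrs
  ...   | ranked-full wcs qr ∷ wos = meld-WellRanked m (wm ∷ wos) (ranked-full wcs qr ∷ []) ∷ ws₀
  step-WellRanked (decrease-key {r = r} _ p il _ m) ws with All-resp-↭ p ws
  ... | wh ∷ ws₀ with replace-All-WellRanked⁻ il wh
  ...   | ranked-full wcs q = meld-WellRanked m
          (replace-All-WellRanked⁺ il refl (keep-WellRanked r wcs q) wh) (move-WellRanked r wcs q ∷ []) ∷ ws₀
  step-WellRanked (delete-below-min p il) ws with All-resp-↭ p ws
  ... | wh ∷ ws₀ = make-hollow-WellRanked (hd (there il)) wh ∷ ws₀
  step-WellRanked (delete-other-tree p il) ws with All-resp-↭ p ws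
  ... | wh ∷ ws₀ = make-hollow-WellRanked (tl il) wh ∷ ws₀
  step-WellRanked (delete-min p d l mf) ws with All-resp-↭ p ws
  ... | (wu ∷ wrs) ∷ ws₀ = All-resp-↭ (↭-sym (minFirst-↭ mf)) (delete-min-WellRanked wu wrs d l) ∷ ws₀

  run-amortized : ∀ {S S′ A B} → Run S S′ A B → All (All WellRanked) S → A + Φ S′ ≤ Φ S + 14 * B
  run-amortized {S} done _ = ≤-reflexive (sym (+-identityʳ (Φ S)))
  run-amortized {S} (step {b = b} {a} {S′} {S″} {A} {B} st r) ws = begin
    a + A + Φ S″                    ≡⟨ +-assoc a A (Φ S″) ⟩
    a + (A + Φ S″)                  ≤⟨ +-monoʳ-≤ a (run-amortized r (step-WellRanked st ws)) ⟩
    a + (Φ S′ + 14 * B)             ≡⟨ +-assoc a (Φ S′) (14 * B) ⟨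
    a + Φ S′ + 14 * B               ≤⟨ +-monoˡ-≤ (14 * B) (step-amortized st ws) ⟩
    Φ S + 14 * budget b + 14 * B    ≡⟨ +-assoc (Φ S) (14 * budget b) (14 * B) ⟩
    Φ S + (14 * budget b + 14 * B)  ≡⟨ cong (Φ S +_) (*-distribˡ-+ 14 (budget b) B) ⟨
    Φ S + 14 * (budget b + B)       ∎

theorem2p4 : Σ ℕ λ c → (O : TotalOrder 0ℓ 0ℓ 0ℓ) (Item : Set) →
    ∀ {S A B} → HollowHeap.Run O Item [] S A B → A ≤ c * B
theorem2p4 = 14 , λ O Item {S} {A} r →
  ≤-trans (m≤m+n A (Amortization.Φ O Item S)) (Amortization.run-amortized O Item r [])
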